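{- For every polynomial $P=(B^{n_1}B)\circ\cdots\circ(B^{n_k}B)$ there exists a decreasing polynomial $P'$ that is $\beta\eta$-equivalent to $P$ such that $P$ and $P'$ have the same length and the lowest degree of $P$ equals the lowest degree of $P'$.
   Context: $B=\lambda f.\lambda g.\lambda x.\, f\,(g\,x)$. A $B$-term is a combinatory term built from $B$ alone by application; two $B$-terms are equivalent if their associated $\lambda$-terms are $\beta\eta$-equivalent. For $B$-terms $e_1,e_2$ write $e_1\circ e_2$ for $B\,e_1\,e_2$ ($\circ$ is associative up to equivalence, so parentheses are omitted). Define $B^0B=B$ and $B^{n+1}B = B\,(B^nB)$; these terms are called monomials. A polynomial is a $B$-term of the form $(B^{n_1}B)\circ(B^{n_2}B)\circ\cdots\circ(B^{n_k}B)$ with $k>0$ and integers $n_1,\dots,n_k\ge 0$; $k$ is its length and $n_1,\dots,n_k$ are its degrees. It is decreasing if $n_1\ge n_2\ge\cdots\ge n_k$. The lowest degree is $\min_i n_i$. -}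

module Defs where

open import Data.Nat using (ℕ; zero; suc; _≥_; _⊓_)
open import Data.List.NonEmpty using (List⁺; _∷_; toList; foldr₁)
import Data.List
open import Data.List using ([]; _∷_)
open import Data.List.Relation.Unary.Linked using (Linked)
open import Relation.Binary.Construct.Closure.Equivalence using (EqClosure)

data Term : Set where
  var : ℕ → Term
  lam : Term → Term
  app : Term → Term → Term

ext : (ℕ → ℕ) → ℕ → ℕ
ext ρ zero    = zero
ext ρ (suc n) = suc (ρ n)

rename : (ℕ → ℕ) → Term → Term
rename ρ (var x)   = var (ρ x)
rename ρ (lam t)   = lam (rename (ext ρ) t)
rename ρ (app t u) = app (rename ρ t) (rename ρ u)

exts : (ℕ → Term) → ℕ → Term
exts σ zero    = var zero
exts σ (suc n) = rename suc (σ n)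

subst : (ℕ → Term) → Term → Term
subst σ (var x)   = σ x
subst σ (lam t)   = lam (subst (exts σ) t)
subst σ (app t u) = app (subst σ t) (subst σ u)

single : Term → ℕ → Term
single u zero    = u
single u (suc n) = var n

_[_] : Term → Term → Term
t [ u ] = subst (single u) t

data _⟶_ : Term → Term → Set where
  β    : ∀ {t u} → app (lam t) u ⟶ (t [ u ])
  η    : ∀ {t} → lam (app (rename suc t) (var zero)) ⟶ t
  ξlam : ∀ {t t'} → t ⟶ t' → lam t ⟶ lam t'
  ξl   : ∀ {t t' u} → t ⟶ t' → app t u ⟶ app t' u
  ξr   : ∀ {t u u'} → u ⟶ u' → app t u ⟶ app t u'

_≡βη_ : Term → Term → Set
_≡βη_ = EqClosure _⟶_

data BTerm : Set where
  B   : BTerm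
  _·_ : BTerm → BTerm → BTerm

infixl 9 _·_

-- B = λf.λg.λx. f (g x)
⟦_⟧ : BTerm → Term
⟦ B ⟧     = lam (lam (lam (app (var 2) (app (var 1) (var 0)))))
⟦ e · f ⟧ = app ⟦ e ⟧ ⟦ f ⟧

_≈_ : BTerm → BTerm → Set
e₁ ≈ e₂ = ⟦ e₁ ⟧ ≡βη ⟦ e₂ ⟧

_∘_ : BTerm → BTerm → BTerm
e₁ ∘ e₂ = B · e₁ · e₂

infixr 5 _∘_

mono : ℕ → BTerm
mono zero    = B
mono (suc n) = B · mono n

polyAux : ℕ → Data.List.List ℕ → BTerm
polyAux n []       = mono n
polyAux n (m ∷ ns) = mono n ∘ polyAux m ns

poly : List⁺ ℕ → BTerm
poly (n ∷ ns) = polyAux n ns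

len : List⁺ ℕ → ℕ
len ns = Data.List.NonEmpty.length ns

decreasing : List⁺ ℕ → Set
decreasing ns = Linked _≥_ (toList ns)

lowest : List⁺ ℕ → ℕ
lowest = foldr₁ _⊓_

module Submission where

-- Everything rests on one commutation rule: for n < d,
--   (BⁿB) ∘ (BᵈB) ≈ (Bᵈ⁺¹B) ∘ (BⁿB).
-- Since Bⁿ B a b₁ … bₙ c d reduces to a b₁ … bₙ (c d), both sides applied to
-- enough arguments reduce to the same term, and η-expansion turns this into an
-- equivalence of the combinators. Insertion sort with this rule as the swap moves
-- each degree n to the left past the larger degrees d, raising each such d by one.
-- This keeps the length, yields a decreasing list, and leaves the minimum
-- unchanged because only degrees above n are raised.

open import Defs
open import Data.Nat using (ℕ; zero; suc; _+_; _≤_; _<_; _≥_; _⊓_; _≤?_; s≤s)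
open import Data.Nat.Properties
  using (+-suc; +-identityʳ; suc-injective; ≰⇒>; <⇒≤; m≤n⇒m≤1+n; m≤n⇒∃[o]m+o≡n;
         m≤n⇒m⊓n≡m; m≥n⇒m⊓n≡n; ⊓-assoc)
open import Data.List using (List; []; _∷_; _++_; foldl; length)
open import Data.List.Properties using (++-assoc; length-++)
open import Data.List.NonEmpty using (List⁺; _∷_; toList)
open import Data.List.Relation.Unary.Linked using (Linked; [-]; _∷_)
open import Data.Product using (Σ; _×_; _,_)
open import Relation.Binary.Bundles using (Setoid)
open import Relation.Binary.PropositionalEquality
  using (_≡_; refl; sym; trans; cong; cong₂; subst₂; module ≡-Reasoning)
open import Relation.Binary.Construct.Closure.Equivalence using (gmap; return; setoid)
open import Relation.Nullary using (yes; no)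
import Relation.Binary.Reasoning.Setoid as SetoidReasoning

subst-rename : ∀ {σ τ} ρ → (∀ x → σ (ρ x) ≡ τ x) → ∀ t → subst σ (rename ρ t) ≡ subst τ t
subst-rename ρ h (var x)   = h x
subst-rename ρ h (lam t)   =
  cong lam (subst-rename (ext ρ) (λ { zero → refl ; (suc x) → cong (rename suc) (h x) }) t)
subst-rename ρ h (app t u) = cong₂ app (subst-rename ρ h t) (subst-rename ρ h u)

subst-renaming : ∀ {σ} ρ → (∀ x → σ x ≡ var (ρ x)) → ∀ t → subst σ t ≡ rename ρ t
subst-renaming ρ h (var x)   = h x
subst-renaming ρ h (lam t)   =
  cong lam (subst-renaming (ext ρ) (λ { zero → refl ; (suc x) → cong (rename suc) (h x) }) t)
subst-renaming ρ h (app t u) = cong₂ app (subst-renaming ρ h t) (subst-renaming ρ h u)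

subst-id : ∀ {σ} → (∀ x → σ x ≡ var x) → ∀ t → subst σ t ≡ t
subst-id h (var x)   = h x
subst-id h (lam t)   = cong lam (subst-id (λ { zero → refl ; (suc x) → cong (rename suc) (h x) }) t)
subst-id h (app t u) = cong₂ app (subst-id h t) (subst-id h u)

rename-suc-[] : ∀ u t → rename suc t [ u ] ≡ t
rename-suc-[] u t = trans (subst-rename {τ = var} suc (λ _ → refl) t) (subst-id (λ _ → refl) t)

exts-single-rename-suc² : ∀ u t → subst (exts (single u)) (rename suc (rename suc t)) ≡ rename suc t
exts-single-rename-suc² u t = begin
  subst (exts (single u)) (rename suc (rename suc t))   ≡⟨ subst-rename suc (λ _ → refl) (rename suc t) ⟩
  subst (λ x → rename suc (single u x)) (rename suc t)  ≡⟨ subst-rename {τ = λ x → var (suc x)} suc (λ _ → refl) t ⟩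
  subst (λ x → var (suc x)) t                           ≡⟨ subst-renaming suc (λ _ → refl) t ⟩
  rename suc t                                          ∎
  where open ≡-Reasoning

βη-setoid : Setoid _ _
βη-setoid = setoid _⟶_

open Setoid βη-setoid using ()
  renaming (refl to ≡βη-refl; sym to ≡βη-sym; trans to ≡βη-trans; reflexive to ≡⇒≡βη)

app-congˡ : ∀ {t t' u} → t ≡βη t' → app t u ≡βη app t' u
app-congˡ = gmap (λ t → app t _) ξl

app-congʳ : ∀ {t u u'} → u ≡βη u' → app t u ≡βη app t u'
app-congʳ = gmap (app _) ξr

lam-cong : ∀ {t t'} → t ≡βη t' → lam t ≡βη lam t'
lam-cong = gmap lam ξlam

module ≡βη-Reasoning = SetoidReasoning βη-setoid

B-β : ∀ f g x → app (app (app ⟦ B ⟧ f) g) x ≡βη app f (app g x)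
B-β f g x =
  ≡βη-trans (return (ξl (ξl β))) (≡βη-trans (return (ξl β)) (≡βη-trans (return β)
    (≡⇒≡βη (cong₂ app (trans (cong (subst (single x)) (exts-single-rename-suc² g f)) (rename-suc-[] x f))
                      (cong (λ g' → app g' x) (rename-suc-[] x g))))))

spine : Term → List Term → Term
spine = foldl app

spine-congˡ : ∀ {t t'} xs → t ≡βη t' → spine t xs ≡βη spine t' xs
spine-congˡ []       t≡t' = t≡t'
spine-congˡ (x ∷ xs) t≡t' = spine-congˡ xs (app-congˡ t≡t')

weaken : ℕ → Term → Term
weaken zero    t = t
weaken (suc k) t = weaken k (rename suc t)

weaken-app : ∀ k t u → weaken k (app t u) ≡ app (weaken k t) (weaken k u)
weaken-app zero    t u = refl
weaken-app (suc k) t u = weaken-app k (rename suc t) (rename suc u)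

weaken-var : ∀ k x → weaken k (var x) ≡ var (k + x)
weaken-var zero    x = refl
weaken-var (suc k) x = trans (weaken-var k (suc x)) (cong var (+-suc k x))

rename-⟦⟧ : ∀ ρ e → rename ρ ⟦ e ⟧ ≡ ⟦ e ⟧
rename-⟦⟧ ρ B       = refl
rename-⟦⟧ ρ (e · f) = cong₂ app (rename-⟦⟧ ρ e) (rename-⟦⟧ ρ f)

weaken-⟦⟧ : ∀ k e → weaken k ⟦ e ⟧ ≡ ⟦ e ⟧
weaken-⟦⟧ zero    e = refl
weaken-⟦⟧ (suc k) e = trans (cong (weaken k) (rename-⟦⟧ suc e)) (weaken-⟦⟧ k e)

-- the variables bound by k λs, outermost first
vars : ℕ → List Term
vars zero    = []
vars (suc k) = var k ∷ vars k

length-vars : ∀ k → length (vars k) ≡ k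
length-vars zero    = refl
length-vars (suc k) = cong suc (length-vars k)

η-ext : ∀ {t u} → app (rename suc t) (var 0) ≡βη app (rename suc u) (var 0) → t ≡βη u
η-ext t≡u = ≡βη-trans (≡βη-sym (return η)) (≡βη-trans (lam-cong t≡u) (return η))

weaken-ext : ∀ k t u → spine (weaken k t) (vars k) ≡βη spine (weaken k u) (vars k) → t ≡βη u
weaken-ext zero    t u t≡u = t≡u
weaken-ext (suc k) t u t≡u = η-ext (weaken-ext k _ _ (subst₂ _≡βη_ (unfold t) (unfold u) t≡u))
  where
  unfold : ∀ t → spine (weaken (suc k) t) (vars (suc k))
               ≡ spine (weaken k (app (rename suc t) (var 0))) (vars k)
  unfold t = sym (cong (λ s → spine s (vars k))
    (trans (weaken-app k (rename suc t) (var 0)) (cong (app _) (trans (weaken-var k 0) (cong var (+-identityʳ k))))))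

≈-ext : ∀ k e f → (∀ xs → length xs ≡ k → spine ⟦ e ⟧ xs ≡βη spine ⟦ f ⟧ xs) → e ≈ f
≈-ext k e f e≡f = weaken-ext k ⟦ e ⟧ ⟦ f ⟧
  (subst₂ (λ t u → spine t (vars k) ≡βη spine u (vars k)) (sym (weaken-⟦⟧ k e)) (sym (weaken-⟦⟧ k f))
    (e≡f (vars k) (length-vars k)))

mono-β : ∀ {n} a bs c d rest → length bs ≡ n →
  spine ⟦ mono n ⟧ (a ∷ bs ++ c ∷ d ∷ rest) ≡βη spine a (bs ++ app c d ∷ rest)
mono-β a []       c d rest refl = spine-congˡ rest (B-β a c d)
mono-β a (b ∷ bs) c d rest refl =
  ≡βη-trans (spine-congˡ (bs ++ c ∷ d ∷ rest) (B-β ⟦ mono (length bs) ⟧ a b)) (mono-β (app a b) bs c d rest refl)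

length-++-∷ : ∀ (xs : List Term) y ys → length (xs ++ y ∷ ys) ≡ suc (length xs + length ys)
length-++-∷ xs y ys = trans (length-++ xs) (+-suc (length xs) (length ys))

mono-commute-spine : ∀ h bs c d ys e f →
  let m = length bs ; k = length ys ; args = bs ++ c ∷ d ∷ ys ++ e ∷ f ∷ [] in
  spine (app ⟦ mono m ⟧ (app ⟦ mono (suc (m + k)) ⟧ h)) args
    ≡βη spine (app ⟦ mono (suc (suc (m + k))) ⟧ (app ⟦ mono m ⟧ h)) args
mono-commute-spine h bs c d ys e f = begin
  spine ⟦ mono m ⟧ (app ⟦ mono (suc (m + k)) ⟧ h ∷ bs ++ c ∷ d ∷ ys ++ e ∷ f ∷ [])
    ≈⟨ mono-β _ bs c d _ refl ⟩
  spine ⟦ mono (suc (m + k)) ⟧ (h ∷ bs ++ app c d ∷ ys ++ e ∷ f ∷ [])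
    ≡⟨ cong (λ zs → spine ⟦ mono (suc (m + k)) ⟧ (h ∷ zs)) (++-assoc bs (app c d ∷ ys) (e ∷ f ∷ [])) ⟨
  spine ⟦ mono (suc (m + k)) ⟧ (h ∷ (bs ++ app c d ∷ ys) ++ e ∷ f ∷ [])
    ≈⟨ mono-β h (bs ++ app c d ∷ ys) e f [] (length-++-∷ bs (app c d) ys) ⟩
  spine h ((bs ++ app c d ∷ ys) ++ app e f ∷ [])
    ≡⟨ cong (spine h) (++-assoc bs (app c d ∷ ys) (app e f ∷ [])) ⟩
  spine h (bs ++ app c d ∷ ys ++ app e f ∷ [])
    ≈⟨ mono-β h bs c d (ys ++ app e f ∷ []) refl ⟨
  spine ⟦ mono m ⟧ (h ∷ bs ++ c ∷ d ∷ ys ++ app e f ∷ [])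
    ≡⟨ cong (λ zs → spine ⟦ mono m ⟧ (h ∷ zs)) (++-assoc bs (c ∷ d ∷ ys) (app e f ∷ [])) ⟨
  spine (app ⟦ mono m ⟧ h) ((bs ++ c ∷ d ∷ ys) ++ app e f ∷ [])
    ≈⟨ mono-β (app ⟦ mono m ⟧ h) (bs ++ c ∷ d ∷ ys) e f [] ∣bs++c∷d∷ys∣ ⟨
  spine ⟦ mono (suc (suc (m + k))) ⟧ (app ⟦ mono m ⟧ h ∷ (bs ++ c ∷ d ∷ ys) ++ e ∷ f ∷ [])
    ≡⟨ cong (λ zs → spine ⟦ mono (suc (suc (m + k))) ⟧ (app ⟦ mono m ⟧ h ∷ zs))
            (++-assoc bs (c ∷ d ∷ ys) (e ∷ f ∷ [])) ⟩
  spine ⟦ mono (suc (suc (m + k))) ⟧ (app ⟦ mono m ⟧ h ∷ bs ++ c ∷ d ∷ ys ++ e ∷ f ∷ []) ∎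
  where
  open ≡βη-Reasoning
  m = length bs
  k = length ys
  ∣bs++c∷d∷ys∣ : length (bs ++ c ∷ d ∷ ys) ≡ suc (suc (m + k))
  ∣bs++c∷d∷ys∣ = trans (length-++-∷ bs c (d ∷ ys)) (cong suc (+-suc m k))

++-split : ∀ {A : Set} m {n} (xs : List A) → length xs ≡ m + n →
  Σ (List A) λ ys → Σ (List A) λ zs → length ys ≡ m × length zs ≡ n × xs ≡ ys ++ zs
++-split zero    xs       ∣xs∣ = [] , xs , refl , ∣xs∣ , refl
++-split (suc m) (x ∷ xs) ∣xs∣ with ++-split m xs (suc-injective ∣xs∣)
... | ys , zs , ∣ys∣ , ∣zs∣ , refl = x ∷ ys , zs , cong suc ∣ys∣ , ∣zs∣ , refl

mono-commute : ∀ m k h xs → length xs ≡ m + (2 + (k + 2)) →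
  spine (app ⟦ mono m ⟧ (app ⟦ mono (suc (m + k)) ⟧ h)) xs
    ≡βη spine (app ⟦ mono (suc (suc (m + k))) ⟧ (app ⟦ mono m ⟧ h)) xs
mono-commute m k h xs ∣xs∣ with ++-split m xs ∣xs∣
... | bs , c ∷ d ∷ rest , refl , ∣rest∣ , refl with ++-split k rest (suc-injective (suc-injective ∣rest∣))
... | ys , e ∷ f ∷ [] , refl , _ , refl = mono-commute-spine h bs c d ys e f

applyTail : List ℕ → Term → Term
applyTail []      x = x
applyTail (r ∷ R) x = app ⟦ polyAux r R ⟧ x

polyAux-β : ∀ d R x → app ⟦ polyAux d R ⟧ x ≡βη app ⟦ mono d ⟧ (applyTail R x)
polyAux-β d []      x = ≡βη-refl
polyAux-β d (r ∷ R) x = B-β _ _ x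

polyAux-β² : ∀ a b R x →
  app ⟦ polyAux a (b ∷ R) ⟧ x ≡βη app ⟦ mono a ⟧ (app ⟦ mono b ⟧ (applyTail R x))
polyAux-β² a b R x = ≡βη-trans (polyAux-β a (b ∷ R) x) (app-congʳ (polyAux-β b R x))

polyAux-swap : ∀ {n d} R → n < d → polyAux n (d ∷ R) ≈ polyAux (suc d) (n ∷ R)
polyAux-swap {n} R n<d with m≤n⇒∃[o]m+o≡n n<d
... | k , refl = ≈-ext (suc (n + (2 + (k + 2)))) _ _ λ where
  (x ∷ xs) ∣xs∣ → begin
    spine (app ⟦ polyAux n (suc (n + k) ∷ R) ⟧ x) xs
      ≈⟨ spine-congˡ xs (polyAux-β² n _ R x) ⟩
    spine (app ⟦ mono n ⟧ (app ⟦ mono (suc (n + k)) ⟧ (applyTail R x))) xs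
      ≈⟨ mono-commute n k (applyTail R x) xs (suc-injective ∣xs∣) ⟩
    spine (app ⟦ mono (suc (suc (n + k))) ⟧ (app ⟦ mono n ⟧ (applyTail R x))) xs
      ≈⟨ spine-congˡ xs (polyAux-β² _ n R x) ⟨
    spine (app ⟦ polyAux (suc (suc (n + k))) (n ∷ R) ⟧ x) xs ∎
    where open ≡βη-Reasoning

-- Passing n to the left of a larger degree d raises d by one (polyAux-swap).
insert : ℕ → List ℕ → List⁺ ℕ
insert n []      = n ∷ []
insert n (d ∷ R) with d ≤? n
... | yes _ = n ∷ d ∷ R
... | no  _ = suc d ∷ toList (insert n R)

normalise : ℕ → List ℕ → List⁺ ℕ
normalise n []       = n ∷ []
normalise n (m ∷ ns) = insert n (toList (normalise m ns))

poly-insert : ∀ n L → poly (insert n L) ≈ polyAux n L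
poly-insert n []      = ≡βη-refl
poly-insert n (d ∷ R) with d ≤? n
... | yes _   = ≡βη-refl
... | no  d≰n = ≡βη-trans (app-congʳ (poly-insert n R)) (≡βη-sym (polyAux-swap R (≰⇒> d≰n)))

len-insert : ∀ n L → len (insert n L) ≡ suc (length L)
len-insert n []      = refl
len-insert n (d ∷ R) with d ≤? n
... | yes _ = refl
... | no  _ = cong suc (len-insert n R)

suc-⊓-swap : ∀ {n d} → n < d → suc d ⊓ n ≡ n ⊓ d
suc-⊓-swap n<d = trans (m≥n⇒m⊓n≡n (m≤n⇒m≤1+n (<⇒≤ n<d))) (sym (m≤n⇒m⊓n≡m (<⇒≤ n<d)))

lowest-insert : ∀ n L → lowest (insert n L) ≡ lowest (n ∷ L)
lowest-insert n []      = refl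
lowest-insert n (d ∷ R) with d ≤? n
... | yes _   = refl
... | no  d≰n = trans (cong (suc d ⊓_) (lowest-insert n R)) (raise R)
  where
  n<d = ≰⇒> d≰n
  raise : ∀ R → suc d ⊓ lowest (n ∷ R) ≡ lowest (n ∷ d ∷ R)
  raise []      = suc-⊓-swap n<d
  raise (r ∷ R) = begin
    suc d ⊓ (n ⊓ lowest (r ∷ R))  ≡⟨ ⊓-assoc (suc d) n _ ⟨
    (suc d ⊓ n) ⊓ lowest (r ∷ R)  ≡⟨ cong (_⊓ lowest (r ∷ R)) (suc-⊓-swap n<d) ⟩
    (n ⊓ d) ⊓ lowest (r ∷ R)      ≡⟨ ⊓-assoc n d _ ⟩
    n ⊓ (d ⊓ lowest (r ∷ R))      ∎
    where open ≡-Reasoning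

insert-below : ∀ {n b} L → n ≤ b → Linked _≥_ (b ∷ L) → Linked _≥_ (suc b ∷ toList (insert n L))
insert-below []      n≤b _ = m≤n⇒m≤1+n n≤b ∷ [-]
insert-below {n} (d ∷ R) n≤b (d≤b ∷ dR) with d ≤? n
... | yes d≤n = m≤n⇒m≤1+n n≤b ∷ d≤n ∷ dR
... | no  d≰n = s≤s d≤b ∷ insert-below R (<⇒≤ (≰⇒> d≰n)) dR

insert-decreasing : ∀ n L → Linked _≥_ L → Linked _≥_ (toList (insert n L))
insert-decreasing n []      _  = [-]
insert-decreasing n (d ∷ R) dR with d ≤? n
... | yes d≤n = d≤n ∷ dR
... | no  d≰n = insert-below R (<⇒≤ (≰⇒> d≰n)) dR

poly-normalise : ∀ n ns → poly (normalise n ns) ≈ polyAux n ns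
poly-normalise n []       = ≡βη-refl
poly-normalise n (m ∷ ns) =
  ≡βη-trans (poly-insert n (toList (normalise m ns))) (app-congʳ (poly-normalise m ns))

len-normalise : ∀ n ns → len (normalise n ns) ≡ suc (length ns)
len-normalise n []       = refl
len-normalise n (m ∷ ns) = trans (len-insert n (toList (normalise m ns))) (cong suc (len-normalise m ns))

lowest-normalise : ∀ n ns → lowest (normalise n ns) ≡ lowest (n ∷ ns)
lowest-normalise n []       = refl
lowest-normalise n (m ∷ ns) =
  trans (lowest-insert n (toList (normalise m ns))) (cong (n ⊓_) (lowest-normalise m ns))

normalise-decreasing : ∀ n ns → decreasing (normalise n ns)
normalise-decreasing n []       = [-]
normalise-decreasing n (m ∷ ns) = insert-decreasing n (toList (normalise m ns)) (normalise-decreasing m ns)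

lemma2p4 : (ns : List⁺ ℕ) →
    Σ (List⁺ ℕ) (λ ms →
      decreasing ms × poly ms ≈ poly ns × len ms ≡ len ns × lowest ms ≡ lowest ns)
lemma2p4 (n ∷ ns) =
  normalise n ns , normalise-decreasing n ns , poly-normalise n ns , len-normalise n ns , lowest-normalise n ns
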